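{- The set $\mathcal{U}$ is not the union of an infinite arithmetic progression $\{m_0h+a_0 : h=0,1,2,\dots\}$ of positive odd integers (with $m_0,a_0$ positive integers) and a set of asymptotic density zero.
   Context: $\mathcal{U}$ denotes the set of positive odd integers $n$ that cannot be written as $n=p+2^k$ with $p$ a prime and $k$ a positive integer. A set $A$ of positive integers has asymptotic density $\delta$ if $|A\cap[1,x]|/x\to\delta$ as $x\to\infty$. -}

module Defs where

open import Data.Nat using (ℕ; _+_; _*_; _^_; _≤_; _%_)
open import Data.Nat.Primality using (Prime)
open import Data.Product using (Σ; _×_; ∃)
open import Data.List using (List; length)
open import Data.List.Relation.Unary.All using (All)
open import Data.List.Relation.Unary.Unique.Propositional using (Unique)
open import Relation.Binary.PropositionalEquality using (_≡_)
open import Relation.Nullary using (¬_)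

OddN : ℕ → Set
OddN n = n % 2 ≡ 1

PrimePlusPow2 : ℕ → Set
PrimePlusPow2 n = Σ ℕ λ p → Σ ℕ λ k → Prime p × 1 ≤ k × n ≡ p + 2 ^ k

U : ℕ → Set
U n = 1 ≤ n × OddN n × ¬ PrimePlusPow2 n

AP : ℕ → ℕ → ℕ → Set
AP m0 a0 n = ∃ λ h → n ≡ m0 * h + a0

-- Since Z is an arbitrary (not necessarily
-- decidable) predicate, "|Z ∩ [1,x]| ≤ c" is expressed as: every
-- duplicate-free list of elements of Z ∩ [1,x] has length ≤ c.
DensityZero : (ℕ → Set) → Set
DensityZero Z = ∀ k → ∃ λ N → ∀ x → N ≤ x →
  (l : List ℕ) → Unique l → All (λ n → Z n × 1 ≤ n × n ≤ x) l →
  k * length l ≤ x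

{-# OPTIONS --safe #-}
-- Let L = 3·5·7·13·17·241.  Since 2^24 ≡ 1 (mod L), the residue of 2^k modulo L
-- depends only on k mod 24, and for the two odd residues b₀, b₁ modulo 2L every
-- such residue of k is matched by a prime c ∣ L with c ∣ n − 2^k and n − 2^k ≠ c
-- (a covering congruence, checked by computation); so both classes lie in 𝒰.
-- A progression with difference m0·2L inside 𝒰 either lies in the given progression
-- or avoids it, and then lies in the density-zero set, which is impossible.  Hence
-- b₀, b₀ + 2L and b₁ are all ≡ a0 (mod m0), so m0 ∣ gcd (2L, b₁ − b₀) = 2.
-- For m0 = 1 the given progression contains an even number, and for m0 = 2 it
-- contains 3 + 2^k for large k.
module Submission where

open import Defs
open import Data.Nat using (ℕ; zero; suc; _+_; _*_; _∸_; _^_; _≤_; _<_; _%_; _/_; z≤n; s≤s;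
  NonZero; >-nonZero; >-nonZero⁻¹; _<?_; _≟_)
open import Data.Nat.Properties
open import Data.Nat.DivMod
open import Data.Nat.Divisibility
open import Data.Nat.GCD using (gcd; gcd-greatest)
open import Data.Nat.ListAction using (product)
open import Data.Nat.Primality using (Prime; prime?; prime⇒irreducible)
open import Data.Fin using (Fin; toℕ; fromℕ<)
open import Data.Fin.Properties using (toℕ-fromℕ<)
import Data.Fin.Properties as Fin
open import Data.Product using (_×_; _,_; ∃; proj₁; proj₂)
open import Data.Sum using (_⊎_; inj₁; inj₂)
open import Data.List using (List; []; _∷_; length)
open import Data.List.Relation.Unary.All using (All; []; _∷_)
import Data.List.Relation.Unary.All as All
open import Data.List.Relation.Unary.Any using (Any; any?; satisfied)
open import Data.List.Relation.Unary.AllPairs using ([]; _∷_)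
open import Data.List.Relation.Unary.Unique.Propositional using (Unique)
open import Function.Base using (case_of_)
open import Function.Bundles using (_⇔_; Equivalence)
open import Relation.Binary.PropositionalEquality
  using (_≡_; _≢_; refl; sym; trans; cong; cong₂; subst; module ≡-Reasoning)
open import Relation.Nullary using (¬_; Dec; yes; no; _×-dec_; ¬?; contradiction)
open import Relation.Nullary.Decidable using (from-yes)

[m+n]%d≡m%d⇒d∣n : ∀ m n d .{{_ : NonZero d}} → (m + n) % d ≡ m % d → d ∣ n
[m+n]%d≡m%d⇒d∣n m n d eq = ∣m+n∣m⇒∣n (subst (d ∣_) (sym m/d*d+n≡[m+n]/d*d) (n∣m*n ((m + n) / d))) (n∣m*n (m / d))
  where
  open ≡-Reasoning
  m/d*d+n≡[m+n]/d*d : (m / d) * d + n ≡ ((m + n) / d) * d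
  m/d*d+n≡[m+n]/d*d = +-cancelˡ-≡ (m % d) _ _ (begin
      m % d + ((m / d) * d + n)       ≡⟨ +-assoc (m % d) _ n ⟨
      m % d + (m / d) * d + n         ≡⟨ cong (_+ n) (m≡m%n+[m/n]*n m d) ⟨
      m + n                           ≡⟨ m≡m%n+[m/n]*n (m + n) d ⟩
      (m + n) % d + ((m + n) / d) * d ≡⟨ cong (_+ ((m + n) / d) * d) eq ⟩
      m % d + ((m + n) / d) * d       ∎)

^%-periodic : ∀ g t M .{{_ : NonZero t}} .{{_ : NonZero M}} → g ^ t % M ≡ 1 →
              ∀ k → g ^ k % M ≡ g ^ (k % t) % M
^%-periodic g t M gᵗ≡1 k = begin
  g ^ k % M                         ≡⟨ cong (λ v → g ^ v % M) (m≡m%n+[m/n]*n k t) ⟩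
  g ^ (r + q * t) % M               ≡⟨ cong (λ v → g ^ (r + v) % M) (*-comm q t) ⟩
  g ^ (r + t * q) % M               ≡⟨ cong (_% M) (^-distribˡ-+-* g r (t * q)) ⟩
  g ^ r * g ^ (t * q) % M           ≡⟨ cong (λ v → g ^ r * v % M) (^-*-assoc g t q) ⟨
  g ^ r * (g ^ t) ^ q % M           ≡⟨ %-distribˡ-* (g ^ r) ((g ^ t) ^ q) M ⟩
  (g ^ r % M) * ((g ^ t) ^ q % M) % M ≡⟨ cong (λ v → (g ^ r % M) * v % M) (power≡1 q) ⟩
  (g ^ r % M) * 1 % M               ≡⟨ cong (_% M) (*-identityʳ (g ^ r % M)) ⟩
  g ^ r % M % M                     ≡⟨ m%n%n≡m%n (g ^ r) M ⟩
  g ^ r % M                         ∎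
  where
  open ≡-Reasoning
  r = k % t
  q = k / t
  power≡1 : ∀ j → (g ^ t) ^ j % M ≡ 1
  power≡1 zero    = m<n⇒m%n≡m (subst (_< M) gᵗ≡1 (m%n<n (g ^ t) M))
  power≡1 (suc j) = begin
    g ^ t * (g ^ t) ^ j % M                 ≡⟨ %-distribˡ-* (g ^ t) ((g ^ t) ^ j) M ⟩
    (g ^ t % M) * ((g ^ t) ^ j % M) % M     ≡⟨ cong₂ (λ u v → u * v % M) gᵗ≡1 (power≡1 j) ⟩
    1 % M                                   ≡⟨ power≡1 zero ⟩
    1                                       ∎

[m%d+n]%d≡[m+n]%d : ∀ m n d .{{_ : NonZero d}} → (m % d + n) % d ≡ (m + n) % d
[m%d+n]%d≡[m+n]%d m n d = begin
  (m % d + n) % d         ≡⟨ %-distribˡ-+ (m % d) n d ⟩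
  (m % d % d + n % d) % d ≡⟨ cong (λ v → (v + n % d) % d) (m%n%n≡m%n m d) ⟩
  (m % d + n % d) % d     ≡⟨ %-distribˡ-+ m n d ⟨
  (m + n) % d             ∎
  where open ≡-Reasoning

[m+n%d]%d≡[m+n]%d : ∀ m n d .{{_ : NonZero d}} → (m + n % d) % d ≡ (m + n) % d
[m+n%d]%d≡[m+n]%d m n d = begin
  (m + n % d) % d ≡⟨ cong (_% d) (+-comm m (n % d)) ⟩
  (n % d + m) % d ≡⟨ [m%d+n]%d≡[m+n]%d n m d ⟩
  (n + m) % d     ≡⟨ cong (_% d) (+-comm n m) ⟩
  (m + n) % d     ∎
  where open ≡-Reasoning

M∣x+[M∸x%M] : ∀ x M .{{_ : NonZero M}} → M ∣ x + (M ∸ x % M)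
M∣x+[M∸x%M] x M = m%n≡0⇒n∣m _ M (begin
  (x + (M ∸ x % M)) % M     ≡⟨ [m%d+n]%d≡[m+n]%d x _ M ⟨
  (x % M + (M ∸ x % M)) % M ≡⟨ cong (_% M) (m+[n∸m]≡n (m%n≤n x M)) ⟩
  M % M                     ≡⟨ n%n≡0 M ⟩
  0                         ∎)
  where open ≡-Reasoning

-- M ∸ x % M represents -x modulo M, so the hypothesis says c ∣ (p + x) - x.
∣-residue-difference : ∀ {c} p x M .{{_ : NonZero M}} → c ∣ M →
                       c ∣ (p + x) % M + (M ∸ x % M) → c ∣ p
∣-residue-difference {c} p x M c∣M c∣residue = ∣m+n∣m⇒∣n c∣[x+z]+p c∣x+z
  where
  z = M ∸ x % M
  c∣x+z : c ∣ x + z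
  c∣x+z = ∣-trans c∣M (M∣x+[M∸x%M] x M)
  c∣p+x+z : c ∣ p + x + z
  c∣p+x+z = ∣n∣m%n⇒∣m c∣M
    (subst (c ∣_) ([m%d+n]%d≡[m+n]%d (p + x) z M) (%-presˡ-∣ c∣residue c∣M))
  c∣[x+z]+p : c ∣ (x + z) + p
  c∣[x+z]+p = subst (c ∣_) (trans (+-assoc p x z) (+-comm p (x + z))) c∣p+x+z

module Covering (M t : ℕ) .{{_ : NonZero M}} .{{_ : NonZero t}}
                (2ᵗ≡1 : 2 ^ t % M ≡ 1) (moduli : List ℕ) where

  -- M ∸ 2 ^ r % M stands for −2^r: if n ≡ B (mod M) and n = p + 2^k with k ≡ r (mod t),
  -- then c ∣ p and p ≠ c.
  Excludes : ℕ → ℕ → ℕ → Set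
  Excludes B r c = 1 < c × c ∣ M × c ∣ B + (M ∸ 2 ^ r % M) × (c + 2 ^ r) % M ≢ B

  excludes? : ∀ B r c → Dec (Excludes B r c)
  excludes? B r c =
    1 <? c ×-dec c ∣? M ×-dec c ∣? B + (M ∸ 2 ^ r % M) ×-dec ¬? ((c + 2 ^ r) % M ≟ B)

  Covered : ℕ → Set
  Covered B = ∀ (r : Fin t) → Any (Excludes B (toℕ r)) moduli

  covered? : ∀ B → Dec (Covered B)
  covered? B = Fin.all? λ r → any? (excludes? B (toℕ r)) moduli

  2ᵏ≡2ᵏ%ᵗ : ∀ k → 2 ^ k % M ≡ 2 ^ (k % t) % M
  2ᵏ≡2ᵏ%ᵗ = ^%-periodic 2 t M 2ᵗ≡1

  ¬Excludes-prime+2ᵏ : ∀ {c} p k → Prime p → ¬ Excludes ((p + 2 ^ k) % M) (k % t) c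
  ¬Excludes-prime+2ᵏ {c} p k p-prime (1<c , c∣M , c∣residue , c+2ʳ≢n)
    with prime⇒irreducible p-prime
           (∣-residue-difference p (2 ^ k) M c∣M
             (subst (λ v → c ∣ (p + 2 ^ k) % M + (M ∸ v)) (sym (2ᵏ≡2ᵏ%ᵗ k)) c∣residue))
  ... | inj₁ c≡1  = <-irrefl (sym c≡1) 1<c
  ... | inj₂ refl = c+2ʳ≢n (begin
    (c + 2 ^ (k % t)) % M     ≡⟨ [m+n%d]%d≡[m+n]%d c _ M ⟨
    (c + 2 ^ (k % t) % M) % M ≡⟨ cong (λ v → (c + v) % M) (2ᵏ≡2ᵏ%ᵗ k) ⟨
    (c + 2 ^ k % M) % M       ≡⟨ [m+n%d]%d≡[m+n]%d c (2 ^ k) M ⟩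
    (c + 2 ^ k) % M           ∎)
    where open ≡-Reasoning

  covered⇒¬PrimePlusPow2 : ∀ n → Covered (n % M) → ¬ PrimePlusPow2 n
  covered⇒¬PrimePlusPow2 _ covered (p , k , p-prime , _ , refl) =
    let c , excludes = satisfied (covered (fromℕ< (m%n<n k t)))
    in ¬Excludes-prime+2ᵏ {c} p k p-prime
         (subst (λ r → Excludes ((p + 2 ^ k) % M) r c) (toℕ-fromℕ< (m%n<n k t)) excludes)

-- The prime factors of 2^24 − 1.
moduli : List ℕ
moduli = 3 ∷ 5 ∷ 7 ∷ 13 ∷ 17 ∷ 241 ∷ []

L : ℕ
L = product moduli

open Covering L 24 refl moduli

b₀ b₁ : ℕ
b₀ = 9545351
b₁ = b₀ + 15362

covered-b₀ : Covered (b₀ % L)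
covered-b₀ = from-yes (covered? (b₀ % L))

covered-b₁ : Covered (b₁ % L)
covered-b₁ = from-yes (covered? (b₁ % L))

U-progression : ∀ b → 1 ≤ b → OddN b → Covered (b % L) → ∀ h → U (b + h * (2 * L))
U-progression b 1≤b b-odd covered h =
  ≤-trans 1≤b (m≤m+n b _) ,
  trans (%-remove-+ʳ b (∣n⇒∣m*n h (m∣m*n L))) b-odd ,
  covered⇒¬PrimePlusPow2 _ (subst Covered (sym (%-remove-+ʳ b (∣n⇒∣m*n h (n∣m*n 2)))) covered)

progression-terms : ℕ → ℕ → ℕ → List ℕ
progression-terms s d zero    = []
progression-terms s d (suc j) = s + j * d ∷ progression-terms s d j

length-progression-terms : ∀ s d j → length (progression-terms s d j) ≡ j
length-progression-terms s d zero    = refl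
length-progression-terms s d (suc j) = cong suc (length-progression-terms s d j)

All-progression-terms : ∀ {P : ℕ → Set} s d j → (∀ i → P (s + i * d)) → All P (progression-terms s d j)
All-progression-terms s d zero    P∋ = []
All-progression-terms s d (suc j) P∋ = P∋ j ∷ All-progression-terms s d j P∋

progression-terms-< : ∀ s d j → 1 ≤ d → All (_< s + j * d) (progression-terms s d j)
progression-terms-< s d zero    1≤d = []
progression-terms-< s d (suc j) 1≤d =
  +-monoʳ-< s (m<n+m (j * d) 1≤d) ∷
  All.map (λ n<s+jd → <-≤-trans n<s+jd (+-monoʳ-≤ s (m≤n+m (j * d) d))) (progression-terms-< s d j 1≤d)

progression-terms-unique : ∀ s d j → 1 ≤ d → Unique (progression-terms s d j)
progression-terms-unique s d zero    1≤d = []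
progression-terms-unique s d (suc j) 1≤d =
  All.map (λ n<s+jd s+jd≡n → <-irrefl (sym s+jd≡n) n<s+jd) (progression-terms-< s d j 1≤d) ∷
  progression-terms-unique s d j 1≤d

-- The first J terms of the progression lie in [1, s + J d]; with J > s they
-- fill more than a 1/(2d) fraction of that interval.
progression⇒¬DensityZero : ∀ {Z s d} → 1 ≤ s → 1 ≤ d → (∀ i → Z (s + i * d)) → ¬ DensityZero Z
progression⇒¬DensityZero {Z} {s} {d} 1≤s 1≤d Z∋ densityZero = <⇒≱ x<[d+d]*J [d+d]*J≤x
  where
  instance _ = >-nonZero 1≤d
  N = proj₁ (densityZero (d + d))
  J = suc (s + N)
  x = s + J * d
  J≤x : J ≤ x
  J≤x = ≤-trans (m≤m*n J d) (m≤n+m (J * d) s)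
  terms-in-Z : All (λ n → Z n × 1 ≤ n × n ≤ x) (progression-terms s d J)
  terms-in-Z = All.zipWith (λ ((z , 1≤n) , n<x) → z , 1≤n , <⇒≤ n<x)
    ( All-progression-terms {λ n → Z n × 1 ≤ n} s d J (λ i → Z∋ i , ≤-trans 1≤s (m≤m+n s (i * d)))
    , progression-terms-< s d J 1≤d )
  [d+d]*J≤x : (d + d) * J ≤ x
  [d+d]*J≤x = subst (λ l → (d + d) * l ≤ x) (length-progression-terms s d J)
    (proj₂ (densityZero (d + d)) x (≤-trans (m≤n+m N s) (≤-trans (n≤1+n _) J≤x))
      (progression-terms s d J) (progression-terms-unique s d J 1≤d) terms-in-Z)
  x<[d+d]*J : x < (d + d) * J
  x<[d+d]*J = begin-strict
    s + J * d     <⟨ +-monoˡ-< (J * d) (<-≤-trans (n<1+n s) (≤-trans (s≤s (m≤m+n s N)) (m≤m*n J d))) ⟩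
    J * d + J * d ≡⟨ cong₂ _+_ (*-comm J d) (*-comm J d) ⟩
    d * J + d * J ≡⟨ *-distribʳ-+ J d d ⟨
    (d + d) * J   ∎
    where open ≤-Reasoning

AP⇒≡a0 : ∀ {m0 a0 n} .{{_ : NonZero m0}} → AP m0 a0 n → n % m0 ≡ a0 % m0
AP⇒≡a0 {m0} {a0} (h , refl) = %-remove-+ˡ a0 (m∣m*n h)

module ResidueOfProgressions {m0 a0 : ℕ} .{{_ : NonZero m0}} {P Z : ℕ → Set}
         (densityZero : DensityZero Z) (P⊆AP∪Z : ∀ {n} → P n → AP m0 a0 n ⊎ Z n) where

  progression-residue : ∀ {s d} → 1 ≤ s → 1 ≤ d → m0 ∣ d → (∀ i → P (s + i * d)) →
                        s % m0 ≡ a0 % m0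
  progression-residue {s} {d} 1≤s 1≤d m0∣d P∋ with s % m0 ≟ a0 % m0
  ... | yes s≡a0 = s≡a0
  ... | no  s≢a0 = contradiction densityZero (progression⇒¬DensityZero 1≤s 1≤d Z∋)
    where
    Z∋ : ∀ i → Z (s + i * d)
    Z∋ i with P⊆AP∪Z (P∋ i)
    ... | inj₁ ap = contradiction (trans (sym (%-remove-+ʳ s (∣n⇒∣m*n i m0∣d))) (AP⇒≡a0 ap)) s≢a0
    ... | inj₂ z  = z

  subprogression-residue : ∀ b {d} → 1 ≤ b → 1 ≤ d → (∀ h → P (b + h * d)) → b % m0 ≡ a0 % m0
  subprogression-residue b {d} 1≤b 1≤d P∋ =
    progression-residue 1≤b (*-mono-≤ (>-nonZero⁻¹ m0) 1≤d) (m∣m*n d)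
      (λ i → subst (λ v → P (b + v)) (*-assoc i m0 d) (P∋ (i * m0)))

  modulus∣step : ∀ b {d} → 1 ≤ b → 1 ≤ d → (∀ h → P (b + h * d)) → m0 ∣ d
  modulus∣step b {d} 1≤b 1≤d P∋ = [m+n]%d≡m%d⇒d∣n b d m0 (trans
    (subprogression-residue (b + d) (≤-trans 1≤b (m≤m+n b d)) 1≤d
      (λ h → subst P (sym (+-assoc b d (h * d))) (P∋ (suc h))))
    (sym (subprogression-residue b 1≤b 1≤d P∋)))

modulus∣2 : ∀ {m0 a0 Z} .{{_ : NonZero m0}} → DensityZero Z →
            (∀ {n} → U n → AP m0 a0 n ⊎ Z n) → m0 ∣ 2
modulus∣2 {m0} densityZero U⊆AP∪Z = subst (m0 ∣_) gcd≡2 (gcd-greatest m0∣15362 m0∣2L)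
  where
  open ResidueOfProgressions densityZero U⊆AP∪Z
  1≤2L : 1 ≤ 2 * L
  1≤2L = s≤s z≤n
  U₀ : ∀ h → U (b₀ + h * (2 * L))
  U₀ = U-progression b₀ (s≤s z≤n) refl covered-b₀
  U₁ : ∀ h → U (b₁ + h * (2 * L))
  U₁ = U-progression b₁ (s≤s z≤n) refl covered-b₁
  m0∣2L : m0 ∣ 2 * L
  m0∣2L = modulus∣step b₀ (s≤s z≤n) 1≤2L U₀
  m0∣15362 : m0 ∣ 15362
  m0∣15362 = [m+n]%d≡m%d⇒d∣n b₀ 15362 m0
    (trans (subprogression-residue b₁ (s≤s z≤n) 1≤2L U₁) (sym (subprogression-residue b₀ (s≤s z≤n) 1≤2L U₀)))
  gcd≡2 : gcd 15362 (2 * L) ≡ 2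
  gcd≡2 = refl

¬OddN-suc : ∀ n → OddN n → ¬ OddN (suc n)
¬OddN-suc n n-odd 1+n-odd = contradiction (∣⇒≤ 2∣1) λ { (s≤s ()) }
  where
  2∣1 : 2 ∣ 1
  2∣1 = [m+n]%d≡m%d⇒d∣n n 1 2 (trans (cong (_% 2) (+-comm n 1)) (trans 1+n-odd (sym n-odd)))

n<2^n : ∀ n → n < 2 ^ n
n<2^n zero    = s≤s z≤n
n<2^n (suc n) = subst (suc n <_) (cong (2 ^ n +_) (sym (+-identityʳ (2 ^ n))))
                      (+-mono-≤ (m^n>0 2 n) (n<2^n n))

odd⇒AP2 : ∀ {a0 n} → OddN a0 → OddN n → a0 ≤ n → AP 2 a0 n
odd⇒AP2 {a0} a0-odd n-odd a0≤n
  with t , refl ← m≤n⇒∃[o]m+o≡n a0≤n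
  with divides q t≡q*2 ← [m+n]%d≡m%d⇒d∣n a0 t 2 (trans n-odd (sym a0-odd)) = q , (begin
    a0 + t      ≡⟨ cong (a0 +_) t≡q*2 ⟩
    a0 + q * 2  ≡⟨ +-comm a0 (q * 2) ⟩
    q * 2 + a0  ≡⟨ cong (_+ a0) (*-comm q 2) ⟩
    2 * q + a0  ∎)
  where open ≡-Reasoning

-- 3 + 2^(a0+1) is odd and exceeds a0.
AP2∩PrimePlusPow2 : ∀ {a0} → OddN a0 → ∃ λ n → AP 2 a0 n × PrimePlusPow2 n
AP2∩PrimePlusPow2 {a0} a0-odd =
  3 + 2 ^ suc a0 ,
  odd⇒AP2 a0-odd (%-remove-+ʳ 3 {d = 2} (m∣m*n (2 ^ a0)))
    (≤-trans (n≤1+n a0) (≤-trans (<⇒≤ (n<2^n (suc a0))) (m≤n+m _ 3))) ,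
  (3 , suc a0 , from-yes (prime? 3) , s≤s z≤n , refl)

theorem6 : (m0 a0 : ℕ) → 1 ≤ m0 → 1 ≤ a0 → (∀ h → OddN (m0 * h + a0)) →
    (Z : ℕ → Set) → DensityZero Z →
    ¬ (∀ n → U n ⇔ (AP m0 a0 n ⊎ Z n))
theorem6 (suc m) a0 _ _ odd Z densityZero U⇔AP∪Z =
  case ∣⇒≤ (modulus∣2 {suc m} {a0} {Z} densityZero λ {n} → Equivalence.to (U⇔AP∪Z n)) of λ where
    (s≤s z≤n)       → ¬OddN-suc a0 (odd 0) (odd 1)
    (s≤s (s≤s z≤n)) →
      let n , n∈AP , n-PrimePlusPow2 = AP2∩PrimePlusPow2 (odd 0)
      in proj₂ (proj₂ (Equivalence.from (U⇔AP∪Z n) (inj₁ n∈AP))) n-PrimePlusPow2
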